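{- For every integer $k\ge1$, the $k$-lexicographic ranking function template, written in conjunctive normal form with the conjuncts $\delta_i>0$ ($i=1,\ldots,k$); $\ f_i(x)>0$ ($i=1,\ldots,k$); $\ f_i(x')\le f_i(x)\vee\bigvee_{j=1}^{i-1}f_j(x')<f_j(x)-\delta_j$ ($i=1,\ldots,k-1$); and $\ \bigvee_{i=1}^k f_i(x')<f_i(x)-\delta_i$, over function symbols $F=\{f_1,\ldots,f_k\}$ and variables $D=\{\delta_1,\ldots,\delta_k\}$, has degree $\frac12(k-1)(k-2)$.
   Context: Each atom has the form $\sum_{f\in F}(\alpha_f f(x)+\beta_f f(x'))+\sum_{d\in D}\gamma_d d\rhd0$ ($\rhd\in\{\ge,>\}$); a symbol or variable occurs in an atom iff its coefficient there is nonzero. Atom occurrences in the CNF are distinguished even if the same atom occurs in several places. The dependency graph $G_T$ of a template $T$ has node set $D\cup F$ and an undirected edge between $u,v$ (including $u=v$) iff some atom of $T$ contains both; $[u]$ is the connected component of $u$. A coloring $\eta$ maps each atom occurrence to one of white (uncolored), red, blue. The coloring graph $G_\eta$ is the directed graph on the connected components of $G_T$ with an edge $([u],[v])$ iff for some conjunct, $u$ occurs in a red occurrence and $v$ occurs in a blue occurrence of that conjunct. $\eta$ is suitable iff (a) every conjunct contains exactly one red occurrence; (b) for all $u,v$ occurring in two different blue occurrences, there is no path between $u$ and $v$ in $G_T$; (c) $G_\eta$ is acyclic. $\deg_T(\eta)$ is the number of uncolored occurrences, and the degree of $T$ is the minimum of $\deg_T(\eta)$ over all suitable colorings $\eta$.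 -}

module Defs where

open import Data.Nat using (ℕ; zero; suc; _+_; _*_; _∸_; _<?_)
open import Data.Integer using (ℤ; 0ℤ; 1ℤ; -1ℤ)
open import Data.Fin using (Fin; zero; suc; toℕ)
open import Data.Fin.Properties using () renaming (_≟_ to _≟ᶠ_)
open import Data.List using (List; []; _∷_; length; lookup; map; filter; allFin; _++_)
open import Data.Bool using (Bool; true; false)
open import Data.Sum using (_⊎_; inj₁; inj₂)
open import Data.Product using (Σ; _×_; _,_; proj₁; proj₂; ∃)
open import Relation.Nullary using (¬_; yes; no)
open import Relation.Binary.PropositionalEquality using (_≡_; _≢_)
open import Relation.Binary.Construct.Closure.ReflexiveTransitive using (Star)
open import Relation.Binary.Construct.Closure.Transitive using (TransClosure)

-- Atoms over function symbols F = Fin m and variables D = Fin n: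
--   Σ_f (α_f f(x) + β_f f(x')) + Σ_d γ_d d  ⊳ 0,   ⊳ ∈ {≥, >}

data Cmp : Set where
  geq gt : Cmp

record Atom (m n : ℕ) : Set where
  constructor atom
  field
    α   : Fin m → ℤ
    β   : Fin m → ℤ
    γ   : Fin n → ℤ
    cmp : Cmp
open Atom public

-- Nodes of the dependency graph: D ∪ F  (inj₁ = function symbol, inj₂ = variable)
Node : ℕ → ℕ → Set
Node m n = Fin m ⊎ Fin n

OccursIn : ∀ {m n} → Node m n → Atom m n → Set
OccursIn (inj₁ f) a = (α a f ≢ 0ℤ) ⊎ (β a f ≢ 0ℤ)
OccursIn (inj₂ d) a = γ a d ≢ 0ℤ

-- A template in CNF: a list of conjuncts, each a list (disjunction) of atom occurrences.
Template : ℕ → ℕ → Set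
Template m n = List (List (Atom m n))

Occ : ∀ {m n} → Template m n → Set
Occ T = Σ (Fin (length T)) λ c → Fin (length (lookup T c))

atomAt : ∀ {m n} (T : Template m n) → Occ T → Atom m n
atomAt T (c , p) = lookup (lookup T c) p

Edge : ∀ {m n} → Template m n → Node m n → Node m n → Set
Edge T u v = Σ (Occ T) λ o → OccursIn u (atomAt T o) × OccursIn v (atomAt T o)

-- path in G_T (reflexive-transitive closure); [u] = [v] iff Path T u v
Path : ∀ {m n} → Template m n → Node m n → Node m n → Set
Path T = Star (Edge T)

data Color : Set where
  white red blue : Color

Coloring : ∀ {m n} → Template m n → Set
Coloring T = Occ T → Color

ColEdgeRaw : ∀ {m n} (T : Template m n) → Coloring T → Node m n → Node m n → Set
ColEdgeRaw T η u v =
  Σ (Fin (length T)) λ c → Σ (Fin (length (lookup T c))) λ p → Σ (Fin (length (lookup T c))) λ q →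
    (η (c , p) ≡ red) × (η (c , q) ≡ blue) ×
    OccursIn u (atomAt T (c , p)) × OccursIn v (atomAt T (c , q))

-- edge of G_η lifted to nodes: ([u],[v]) is an edge of G_η
ColEdge : ∀ {m n} (T : Template m n) → Coloring T → Node m n → Node m n → Set
ColEdge T η u v = ∃ λ u' → ∃ λ v' → Path T u u' × ColEdgeRaw T η u' v' × Path T v' v

ExactlyOneRed : ∀ {m n} (T : Template m n) → Coloring T → Set
ExactlyOneRed T η = (c : Fin (length T)) →
  Σ (Fin (length (lookup T c))) λ p → (η (c , p) ≡ red) ×
    ((q : Fin (length (lookup T c))) → η (c , q) ≡ red → q ≡ p)

BlueSeparated : ∀ {m n} (T : Template m n) → Coloring T → Set
BlueSeparated {m} {n} T η = (o o' : Occ T) → o ≢ o' → η o ≡ blue → η o' ≡ blue →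
  (u v : Node m n) → OccursIn u (atomAt T o) → OccursIn v (atomAt T o') → ¬ Path T u v

Acyclic : ∀ {m n} (T : Template m n) → Coloring T → Set
Acyclic {m} {n} T η = (u : Node m n) → ¬ TransClosure (ColEdge T η) u u

record Suitable {m n} (T : Template m n) (η : Coloring T) : Set where
  field
    oneRed  : ExactlyOneRed T η
    blueSep : BlueSeparated T η
    acyclic : Acyclic T η

sumFin : ∀ {k} → (Fin k → ℕ) → ℕ
sumFin {zero}  f = 0
sumFin {suc k} f = f zero + sumFin (λ i → f (suc i))

isWhite : Color → ℕ
isWhite white = 1
isWhite red   = 0
isWhite blue  = 0

deg : ∀ {m n} (T : Template m n) → Coloring T → ℕ
deg T η = sumFin λ c → sumFin λ p → isWhite (η (c , p))

open import Data.Nat using (_≤_)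
HasDegree : ∀ {m n} → Template m n → ℕ → Set
HasDegree T N =
  (Σ (Coloring T) λ η → Suitable T η × deg T η ≡ N) ×
  ((η : Coloring T) → Suitable T η → N ≤ deg T η)

-- The k-lexicographic ranking function template (F = {f_1..f_k}, D = {δ_1..δ_k},
-- indices 0-based here)

ind : ∀ {k} → Fin k → ℤ → Fin k → ℤ
ind i z j with i ≟ᶠ j
... | yes _ = z
... | no  _ = 0ℤ

zeroF : ∀ {k} → Fin k → ℤ
zeroF _ = 0ℤ

deltaPos : ∀ {k} → Fin k → Atom k k
deltaPos i = atom zeroF zeroF (ind i 1ℤ) gt

fPos : ∀ {k} → Fin k → Atom k k
fPos i = atom (ind i 1ℤ) zeroF zeroF gt

-- f_i(x') ≤ f_i(x),  i.e.  f_i(x) - f_i(x') ≥ 0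
nonInc : ∀ {k} → Fin k → Atom k k
nonInc i = atom (ind i 1ℤ) (ind i -1ℤ) zeroF geq

-- f_i(x') < f_i(x) - δ_i,  i.e.  f_i(x) - f_i(x') - δ_i > 0
decr : ∀ {k} → Fin k → Atom k k
decr i = atom (ind i 1ℤ) (ind i -1ℤ) (ind i -1ℤ) gt

lexTemplate : (k : ℕ) → Template k k
lexTemplate k =
     map (λ i → deltaPos i ∷ []) (allFin k)
  ++ map (λ i → fPos i ∷ []) (allFin k)
  ++ map (λ i → nonInc i ∷ map decr (filter (λ j → toℕ j <? toℕ i) (allFin k)))
         (filter (λ i → suc (toℕ i) <? k) (allFin k))
  ++ (map decr (allFin k) ∷ [])

module Submission where

-- Write k = m + 1.  The connected components of the dependency graph are the
-- k pairs {f_i, δ_i}: every atom mentions symbols of one index only, and the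
-- atom f_i(x') < f_i(x) - δ_i links f_i with δ_i.
--
-- If every conjunct has exactly one red occurrence, then
-- deg + #blue = Σ_c (|c| - 1) does not depend on the colouring.  In a suitable
-- colouring distinct blue occurrences lie in distinct components, so there are
-- at most k of them; if every component carried one, each component would have
-- an incoming edge of G_η (from the red occurrence of the conjunct of its blue
-- occurrence), and following these edges backwards would close a cycle.  Hence
-- at most m occurrences are blue.
--
-- Colour the first atom of each conjunct red and the remaining
-- ones blue if the first atom is strict, uncoloured otherwise.  Only the final
-- conjunct gets blue atoms (m of them, at the distinct levels 1..m, all
-- reached from the red atom at level 0), and the i-th non-increase conjunct
-- has i uncoloured atoms, giving 0 + 1 + ... + (m-1) = m(m-1)/2.

open import Defs
open import Data.Nat
  using (ℕ; zero; suc; _+_; _*_; _∸_; _/_; _≤_; _<_; _≥_; z≤n; s≤s; z<s; _<?_; _≤?_)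
open import Data.Nat.Properties
  using ( +-0-commutativeMonoid; module ≤-Reasoning; _≟_; +-comm; *-comm; +-identityʳ; *-identityˡ
        ; *-identityʳ; *-zeroʳ; *-distribˡ-∸; m+n∸n≡m; +-cancelʳ-≡; +-cancelʳ-≤; +-mono-≤; +-monoʳ-≤
        ; ≤-trans; <⇒≤; <-irrefl; ≮⇒≥; n≤0⇒n≡0; n≢0⇒n>0; 0≢1+n; n<1+n; n≤1+n; m≤m+n; m≤n+m
        ; m≤n⇒m<n∨m≡n )
open import Data.Nat.DivMod using (m*n/n≡m)
open import Data.Nat.Tactic.RingSolver using (solve-∀)
open import Data.Nat.ListAction using () renaming (sum to listSum)
open import Data.Nat.ListAction.Properties using (sum-++)
open import Algebra.Properties.CommutativeMonoid.Sum +-0-commutativeMonoid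
  using (sum; sum-syntax; sum-cong-≗; sum-remove; ∑-comm; ∑-distrib-+)
open import Data.Integer using (ℤ; 0ℤ; 1ℤ; -1ℤ)
open import Data.Fin using (Fin; toℕ; punchIn) renaming (zero to fzero; suc to fsuc)
open import Data.Fin.Properties using (toℕ-injective; toℕ<n; pigeonhole; any?)
  renaming (_≟_ to _≟ᶠ_; suc-injective to fsuc-injective)
open import Data.List using (List; []; _∷_; length; lookup; map; filter; allFin; tabulate; _++_)
open import Data.List.Properties using (map-++; map-∘; map-cong; length-map; length-tabulate)
open import Data.List.Relation.Unary.All as All using (All; []; _∷_; universal)
open import Data.List.Relation.Unary.All.Properties using (++⁺; map⁺)
open import Data.List.Relation.Unary.Any using (here; there; index)
open import Data.List.Relation.Unary.Any.Properties using (lookup-index)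
open import Data.List.Membership.Propositional using (_∈_)
open import Data.List.Membership.Propositional.Properties using (∈-lookup; ∈-map⁺; ∈-++⁺ʳ; ∈-allFin)
open import Data.Bool using (true; false; if_then_else_)
open import Data.Sum using (inj₁; inj₂)
open import Data.Product using (Σ; _×_; _,_; proj₁; proj₂; ∃)
open import Data.Product.Properties using (≡-dec)
open import Data.Product.Properties.WithK using (,-injectiveʳ)
open import Data.Empty using (⊥-elim)
open import Function using (_∘_)
open import Relation.Nullary using (¬_; yes; no; does)
open import Relation.Unary using (Decidable)
open import Relation.Binary.PropositionalEquality
open import Relation.Binary.Construct.Closure.ReflexiveTransitive using (ε; _◅_; _◅◅_; reverse)
open import Relation.Binary.Construct.Closure.Transitive using (TransClosure; [_]; _∷_)

sumFin≡sum : ∀ {n} (f : Fin n → ℕ) → sumFin f ≡ sum f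
sumFin≡sum {zero}  f = refl
sumFin≡sum {suc n} f = cong (f fzero +_) (sumFin≡sum (f ∘ fsuc))

∑-zero : ∀ {n} {f : Fin n → ℕ} → (∀ i → f i ≡ 0) → sum f ≡ 0
∑-zero {zero}  _    = refl
∑-zero {suc n} f≡0 = cong₂ _+_ (f≡0 fzero) (∑-zero (f≡0 ∘ fsuc))

∑-const : ∀ n c → ∑[ i < n ] c ≡ n * c
∑-const zero    c = refl
∑-const (suc n) c = cong (c +_) (∑-const n c)

∑-mono : ∀ {n} {f g : Fin n → ℕ} → (∀ i → f i ≤ g i) → sum f ≤ sum g
∑-mono {zero}  _  = z≤n
∑-mono {suc n} le = +-mono-≤ (le fzero) (∑-mono (le ∘ fsuc))

∑-point : ∀ {n} (f : Fin n → ℕ) (i : Fin n) → (∀ j → j ≢ i → f j ≡ 0) → sum f ≡ f i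
∑-point f fzero    off = trans (cong (f fzero +_) (∑-zero λ j → off (fsuc j) λ ())) (+-identityʳ _)
∑-point f (fsuc i) off =
  trans (cong (_+ sum (f ∘ fsuc)) (off fzero λ ()))
        (∑-point (f ∘ fsuc) i λ j j≢i → off (fsuc j) (j≢i ∘ fsuc-injective))

∑-pos : ∀ {n} (f : Fin n → ℕ) → 0 < sum f → ∃ λ i → 0 < f i
∑-pos {suc n} f pos with f fzero in f0≡
... | suc _ = fzero , subst (0 <_) (sym f0≡) z<s
... | zero  = let i , fi>0 = ∑-pos (f ∘ fsuc) pos in fsuc i , fi>0

∑-atMostOne : ∀ {n} (f : Fin n → ℕ) → (∀ i → f i ≤ 1) →
              (∀ i j → 0 < f i → 0 < f j → i ≡ j) → sum f ≤ 1
∑-atMostOne f bounded unique with 1 ≤? sum f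
... | no  ∑≯0 = ≤-trans (≮⇒≥ ∑≯0) z≤n
... | yes ∑>0 = subst (_≤ 1) (sym (∑-point f i vanish)) (bounded i)
  where
  i = proj₁ (∑-pos f ∑>0)
  vanish : ∀ j → j ≢ i → f j ≡ 0
  vanish j j≢i = n≤0⇒n≡0 (≮⇒≥ λ fj>0 → j≢i (unique j i fj>0 (proj₂ (∑-pos f ∑>0))))

∑-missing : ∀ {n} (f : Fin n → ℕ) → (∀ i → f i ≤ 1) → (j : Fin n) → f j ≡ 0 → sum f ≤ n ∸ 1
∑-missing {suc n} f bounded j fj≡0 = begin
  sum f                                   ≡⟨ sum-remove {i = j} f ⟩
  f j + ∑[ i < n ] f (punchIn j i)        ≡⟨ cong (_+ ∑[ i < n ] f (punchIn j i)) fj≡0 ⟩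
  ∑[ i < n ] f (punchIn j i)              ≤⟨ ∑-mono (bounded ∘ punchIn j) ⟩
  ∑[ i < n ] 1                            ≡⟨ ∑-const n 1 ⟩
  n * 1                                   ≡⟨ *-identityʳ n ⟩
  n                                       ∎
  where open ≤-Reasoning

δ[_,_] : ∀ {k} → Fin k → Fin k → ℕ
δ[ x , i ] with x ≟ᶠ i
... | yes _ = 1
... | no  _ = 0

δ-diag : ∀ {k} (x : Fin k) → δ[ x , x ] ≡ 1
δ-diag x with x ≟ᶠ x
... | yes _   = refl
... | no  x≢x = ⊥-elim (x≢x refl)

δ-off : ∀ {k} {x i : Fin k} → x ≢ i → δ[ x , i ] ≡ 0
δ-off {x = x} {i} x≢i with x ≟ᶠ i
... | yes x≡i = ⊥-elim (x≢i x≡i)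
... | no  _   = refl

δ*-≤1 : ∀ {k} (x i : Fin k) {v} → v ≤ 1 → δ[ x , i ] * v ≤ 1
δ*-≤1 x i v≤1 with x ≟ᶠ i
... | yes _ = subst (_≤ 1) (sym (+-identityʳ _)) v≤1
... | no  _ = z≤n

δ*-pos : ∀ {k} (x i : Fin k) v → 0 < δ[ x , i ] * v → x ≡ i × 0 < v
δ*-pos x i v pos with x ≟ᶠ i
... | yes x≡i = x≡i , subst (0 <_) (+-identityʳ v) pos
... | no  _   = ⊥-elim (<-irrefl refl pos)

∑-δ : ∀ {k} (x : Fin k) v → ∑[ i < k ] (δ[ x , i ] * v) ≡ v
∑-δ x v = begin
  ∑[ i < _ ] (δ[ x , i ] * v) ≡⟨ ∑-point _ x (λ i i≢x → cong (_* v) (δ-off (i≢x ∘ sym))) ⟩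
  δ[ x , x ] * v             ≡⟨ cong (_* v) (δ-diag x) ⟩
  1 * v                      ≡⟨ *-identityˡ v ⟩
  v                          ∎
  where open ≡-Reasoning

∑-fibres : ∀ {n k} (ℓ : Fin n → Fin k) (g : Fin n → ℕ) →
           sum g ≡ ∑[ i < k ] ∑[ x < n ] (δ[ ℓ x , i ] * g x)
∑-fibres ℓ g = trans (sum-cong-≗ λ x → sym (∑-δ (ℓ x) (g x))) (∑-comm λ x i → δ[ ℓ x , i ] * g x)

∑-below : ∀ {n t} (g : ℕ → ℕ) → t ≤ n →
          ∑[ i < n ] (if does (toℕ i <? t) then g (toℕ i) else 0) ≡ ∑[ i < t ] g (toℕ i)
∑-below {n}     {zero}  g _         =
  ∑-zero {n} {f = λ i → if does (toℕ i <? 0) then g (toℕ i) else 0} λ _ → refl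
∑-below {suc n} {suc t} g (s≤s t≤n) = cong (g 0 +_) (∑-below (g ∘ suc) t≤n)

gauss : ∀ t → 2 * ∑[ i < t ] toℕ i + t ≡ t * t
gauss zero    = refl
gauss (suc t) = begin
  2 * (0 + ∑[ i < t ] suc (toℕ i)) + suc t  ≡⟨ cong (λ s → 2 * s + suc t) shift ⟩
  2 * (∑[ i < t ] toℕ i + t) + suc t        ≡⟨ regroup (∑[ i < t ] toℕ i) t ⟩
  (2 * ∑[ i < t ] toℕ i + t) + (2 * t + 1)  ≡⟨ cong (_+ (2 * t + 1)) (gauss t) ⟩
  t * t + (2 * t + 1)                       ≡⟨ square t ⟩
  suc t * suc t                             ∎
  where
  open ≡-Reasoning
  shift : 0 + ∑[ i < t ] suc (toℕ i) ≡ ∑[ i < t ] toℕ i + t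
  shift = begin
    ∑[ i < t ] (1 + toℕ i)           ≡⟨ ∑-distrib-+ (λ _ → 1) (toℕ {t}) ⟩
    ∑[ i < t ] 1 + ∑[ i < t ] toℕ i  ≡⟨ cong (_+ ∑[ i < t ] toℕ i) (trans (∑-const t 1) (*-identityʳ t)) ⟩
    t + ∑[ i < t ] toℕ i             ≡⟨ +-comm t _ ⟩
    ∑[ i < t ] toℕ i + t             ∎
  regroup : ∀ s t → 2 * (s + t) + suc t ≡ (2 * s + t) + (2 * t + 1)
  regroup = solve-∀
  square : ∀ t → t * t + (2 * t + 1) ≡ suc t * suc t
  square = solve-∀

triangle : ∀ t → ∑[ i < t ] toℕ i ≡ t * (t ∸ 1) / 2
triangle t = sym (trans (cong (_/ 2) twice) (m*n/n≡m S 2))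
  where
  open ≡-Reasoning
  S : ℕ
  S = ∑[ i < t ] toℕ i
  twice : t * (t ∸ 1) ≡ S * 2
  twice = begin
    t * (t ∸ 1)       ≡⟨ *-distribˡ-∸ t t 1 ⟩
    t * t ∸ t * 1     ≡⟨ cong (t * t ∸_) (*-identityʳ t) ⟩
    t * t ∸ t         ≡⟨ cong (_∸ t) (gauss t) ⟨
    2 * S + t ∸ t     ≡⟨ m+n∸n≡m (2 * S) t ⟩
    2 * S             ≡⟨ *-comm 2 S ⟩
    S * 2             ∎

∑-lookup : ∀ {A : Set} (g : A → ℕ) (xs : List A) → ∑[ c < length xs ] g (lookup xs c) ≡ listSum (map g xs)
∑-lookup g []       = refl
∑-lookup g (x ∷ xs) = cong (g x +_) (∑-lookup g xs)

AtMostOneNot : ∀ {A : Set} → (A → Set) → List A → Set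
AtMostOneNot P xs = ∀ i j → ¬ P (lookup xs i) → ¬ P (lookup xs j) → i ≡ j

atMostOneNot-++ : ∀ {A : Set} {P : A → Set} {xs ys : List A} →
                  All P xs → AtMostOneNot P ys → AtMostOneNot P (xs ++ ys)
atMostOneNot-++ []         rest i        j        ¬pi ¬pj = rest i j ¬pi ¬pj
atMostOneNot-++ (px ∷ _)   rest fzero    _        ¬pi _   = ⊥-elim (¬pi px)
atMostOneNot-++ (px ∷ _)   rest (fsuc _) fzero    _   ¬pj = ⊥-elim (¬pj px)
atMostOneNot-++ (_ ∷ pxs)  rest (fsuc i) (fsuc j) ¬pi ¬pj = cong fsuc (atMostOneNot-++ pxs rest i j ¬pi ¬pj)

atMostOneNot-singleton : ∀ {A : Set} {P : A → Set} (y : A) → AtMostOneNot P (y ∷ [])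
atMostOneNot-singleton y fzero fzero _ _ = refl

entry : ∀ {A : Set} {P : A → Set} {xs : List A} → All P xs → (i : Fin (length xs)) → P (lookup xs i)
entry ps i = All.lookup ps (∈-lookup i)

lookup-map-tabulate : ∀ {A B : Set} {n} (g : A → B) (f : Fin n → A) (p : Fin (length (map g (tabulate f)))) →
                      ∃ λ j → lookup (map g (tabulate f)) p ≡ g (f j) × toℕ j ≡ toℕ p
lookup-map-tabulate {n = suc n} g f fzero    = fzero , refl , refl
lookup-map-tabulate {n = suc n} g f (fsuc p) =
  let j , at-p , same = lookup-map-tabulate g (f ∘ fsuc) p in fsuc j , at-p , cong suc same

occurrenceOf : ∀ {m n} {T : Template m n} {xs a} → xs ∈ T → a ∈ xs → Σ (Occ T) λ o → atomAt T o ≡ a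
occurrenceOf {T = T} {a = a} xs∈T a∈xs = (index xs∈T , index a∈conjunct) , sym (lookup-index a∈conjunct)
  where
  a∈conjunct : a ∈ lookup T (index xs∈T)
  a∈conjunct = subst (a ∈_) (lookup-index xs∈T) a∈xs

∈⇒≤listSum : ∀ {n ns} → n ∈ ns → n ≤ listSum ns
∈⇒≤listSum (here refl) = m≤m+n _ _
∈⇒≤listSum {ns = n' ∷ _} (there n∈ns) = ≤-trans (∈⇒≤listSum n∈ns) (m≤n+m _ n')

listSum-map-++ : ∀ {A : Set} (g : A → ℕ) xs ys →
                 listSum (map g (xs ++ ys)) ≡ listSum (map g xs) + listSum (map g ys)
listSum-map-++ g xs ys = trans (cong listSum (map-++ g xs ys)) (sum-++ (map g xs) (map g ys))

listSum-map-zero : ∀ {A : Set} {g : A → ℕ} → (∀ x → g x ≡ 0) → ∀ xs → listSum (map g xs) ≡ 0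
listSum-map-zero g≡0 []       = refl
listSum-map-zero g≡0 (x ∷ xs) = cong₂ _+_ (g≡0 x) (listSum-map-zero g≡0 xs)

listSum-filter : ∀ {A : Set} {P : A → Set} (P? : Decidable P) (g : A → ℕ) {n} (f : Fin n → A) →
                 listSum (map g (filter P? (tabulate f))) ≡ ∑[ i < n ] (if does (P? (f i)) then g (f i) else 0)
listSum-filter P? g {zero}  f = refl
listSum-filter P? g {suc n} f with does (P? (f fzero))
... | true  = cong (g (f fzero) +_) (listSum-filter P? g (f ∘ fsuc))
... | false = listSum-filter P? g (f ∘ fsuc)

length≡listSum : ∀ {A : Set} (xs : List A) → length xs ≡ listSum (map (λ _ → 1) xs)
length≡listSum []       = refl
length≡listSum (_ ∷ xs) = cong suc (length≡listSum xs)

∑Occ : ∀ {m n} (T : Template m n) → (Occ T → ℕ) → ℕ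
∑Occ T g = ∑[ c < length T ] ∑[ p < length (lookup T c) ] g (c , p)

row : ∀ {m n} (T : Template m n) → (Occ T → ℕ) → (c : Fin (length T)) → Fin (length (lookup T c)) → ℕ
row T g c p = g (c , p)

∑Occ-pos : ∀ {m n} (T : Template m n) (g : Occ T → ℕ) → 0 < ∑Occ T g → ∃ λ o → 0 < g o
∑Occ-pos T g pos =
  let c , row>0 = ∑-pos (sum ∘ row T g) pos
      p , gcp>0 = ∑-pos (row T g c) row>0
  in (c , p) , gcp>0

∑Occ-atMostOne : ∀ {m n} (T : Template m n) (g : Occ T → ℕ) → (∀ o → g o ≤ 1) →
                 (∀ o o' → 0 < g o → 0 < g o' → o ≡ o') → ∑Occ T g ≤ 1
∑Occ-atMostOne T g bounded unique = ∑-atMostOne (sum ∘ row T g) row≤1 λ c c' c>0 c'>0 →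
  cong proj₁ (unique _ _ (proj₂ (∑-pos (row T g c) c>0)) (proj₂ (∑-pos (row T g c') c'>0)))
  where
  row≤1 : ∀ c → sum (row T g c) ≤ 1
  row≤1 c = ∑-atMostOne (row T g c) (λ p → bounded (c , p)) λ p q gp gq → ,-injectiveʳ (unique _ _ gp gq)

∑Occ-fibres : ∀ {m n k} (T : Template m n) (ℓ : Occ T → Fin k) (g : Occ T → ℕ) →
              ∑Occ T g ≡ ∑[ i < k ] ∑Occ T (λ o → δ[ ℓ o , i ] * g o)
∑Occ-fibres T ℓ g =
  trans (sum-cong-≗ λ c → ∑-fibres (ℓ ∘ (c ,_)) (g ∘ (c ,_)))
        (∑-comm λ c i → ∑[ p < length (lookup T c) ] (δ[ ℓ (c , p) , i ] * g (c , p)))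

isBlue isRed : Color → ℕ
isBlue blue = 1
isBlue _    = 0
isRed red = 1
isRed _   = 0

isBlue≤1 : ∀ χ → isBlue χ ≤ 1
isBlue≤1 white = z≤n
isBlue≤1 red   = z≤n
isBlue≤1 blue  = s≤s z≤n

isBlue-pos : ∀ {χ} → 0 < isBlue χ → χ ≡ blue
isBlue-pos {blue} _ = refl

blues : ∀ {m n} (T : Template m n) → Coloring T → ℕ
blues T η = ∑Occ T (isBlue ∘ η)

deg≡∑Occ : ∀ {m n} (T : Template m n) (η : Coloring T) → deg T η ≡ ∑Occ T (isWhite ∘ η)
deg≡∑Occ T η =
  trans (sumFin≡sum λ c → sumFin λ p → isWhite (η (c , p)))
        (sum-cong-≗ λ c → sumFin≡sum λ p → isWhite (η (c , p)))

colour-partition : ∀ χ → isWhite χ + isBlue χ + isRed χ ≡ 1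
colour-partition white = refl
colour-partition red   = refl
colour-partition blue  = refl

nonRed-count : ∀ {n} (χ : Fin n → Color) (r : Fin n) → χ r ≡ red → (∀ q → χ q ≡ red → q ≡ r) →
               ∑[ q < n ] (isWhite (χ q) + isBlue (χ q)) + 1 ≡ n
nonRed-count {n} χ r χr≡red onlyR = begin
  ∑[ q < n ] (isWhite (χ q) + isBlue (χ q)) + 1
    ≡⟨ cong (∑[ q < n ] (isWhite (χ q) + isBlue (χ q)) +_) reds≡1 ⟨
  ∑[ q < n ] (isWhite (χ q) + isBlue (χ q)) + ∑[ q < n ] isRed (χ q)
    ≡⟨ ∑-distrib-+ (λ q → isWhite (χ q) + isBlue (χ q)) (isRed ∘ χ) ⟨
  ∑[ q < n ] (isWhite (χ q) + isBlue (χ q) + isRed (χ q))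
    ≡⟨ sum-cong-≗ (colour-partition ∘ χ) ⟩
  ∑[ q < n ] 1
    ≡⟨ trans (∑-const n 1) (*-identityʳ n) ⟩
  n ∎
  where
  open ≡-Reasoning
  notRed : ∀ {χ'} → χ' ≢ red → isRed χ' ≡ 0
  notRed {white} _ = refl
  notRed {blue}  _ = refl
  notRed {red}   r≢r = ⊥-elim (r≢r refl)
  reds≡1 : ∑[ q < n ] isRed (χ q) ≡ 1
  reds≡1 = trans (∑-point _ r λ q q≢r → notRed (q≢r ∘ onlyR q)) (cong isRed χr≡red)

nonRed : ∀ {m n} (T : Template m n) → Coloring T → Fin (length T) → ℕ
nonRed T η c = ∑[ p < length (lookup T c) ] (isWhite (η (c , p)) + isBlue (η (c , p)))

nonRed+1 : ∀ {m n} (T : Template m n) {η : Coloring T} → ExactlyOneRed T η →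
           ∀ c → nonRed T η c + 1 ≡ length (lookup T c)
nonRed+1 T {η} one c = let r , r-red , onlyR = one c in nonRed-count (λ p → η (c , p)) r r-red onlyR

nonRed-invariant : ∀ {m n} (T : Template m n) {η η' : Coloring T} →
                   ExactlyOneRed T η → ExactlyOneRed T η' → ∀ c → nonRed T η c ≡ nonRed T η' c
nonRed-invariant T one one' c = +-cancelʳ-≡ 1 _ _ (trans (nonRed+1 T one c) (sym (nonRed+1 T one' c)))

-- With one red occurrence per conjunct, deg + #blue does not depend on the
-- colouring; so fewer blue occurrences mean a larger degree.
deg-minimal : ∀ {m n} (T : Template m n) {η₀ η : Coloring T} →
              ExactlyOneRed T η₀ → ExactlyOneRed T η → blues T η ≤ blues T η₀ → deg T η₀ ≤ deg T η
deg-minimal T {η₀} {η} one₀ one fewer = +-cancelʳ-≤ (blues T η₀) (deg T η₀) (deg T η) (begin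
  deg T η₀ + blues T η₀  ≡⟨ deg+blues η₀ ⟩
  sum (nonRed T η₀)      ≡⟨ sum-cong-≗ (nonRed-invariant T one₀ one) ⟩
  sum (nonRed T η)       ≡⟨ deg+blues η ⟨
  deg T η + blues T η    ≤⟨ +-monoʳ-≤ (deg T η) fewer ⟩
  deg T η + blues T η₀   ∎)
  where
  open ≤-Reasoning
  whites bluesIn : Coloring T → Fin (length T) → ℕ
  whites  χ c = ∑[ p < length (lookup T c) ] isWhite (χ (c , p))
  bluesIn χ c = ∑[ p < length (lookup T c) ] isBlue (χ (c , p))
  deg+blues : ∀ χ → deg T χ + blues T χ ≡ sum (nonRed T χ)
  deg+blues χ = begin-equality
    deg T χ + blues T χ              ≡⟨ cong (_+ blues T χ) (deg≡∑Occ T χ) ⟩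
    ∑Occ T (isWhite ∘ χ) + blues T χ ≡⟨ ∑-distrib-+ (whites χ) (bluesIn χ) ⟨
    ∑[ c < length T ] (whites χ c + bluesIn χ c)
      ≡⟨ sum-cong-≗ (λ c → ∑-distrib-+ (isWhite ∘ χ ∘ (c ,_)) (isBlue ∘ χ ∘ (c ,_))) ⟨
    sum (nonRed T χ)                 ∎

tailColour : Cmp → Color
tailColour geq = white
tailColour gt  = blue

headColouring : ∀ {m n} (xs : List (Atom m n)) → Fin (length xs) → Color
headColouring (a ∷ _) fzero    = red
headColouring (a ∷ _) (fsuc _) = tailColour (cmp a)

lead : ∀ {m n} (T : Template m n) → Coloring T
lead T (c , p) = headColouring (lookup T c) p

head-only-red : ∀ {m n} (a : Atom m n) as p → headColouring (a ∷ as) p ≡ red → p ≡ fzero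
head-only-red a as fzero    _ = refl
head-only-red a as (fsuc _) tail-red with cmp a
head-only-red a as (fsuc _) () | geq
head-only-red a as (fsuc _) () | gt

lead-oneRed : ∀ {m n} (T : Template m n) → (∀ c → 0 < length (lookup T c)) → ExactlyOneRed T (lead T)
lead-oneRed T nonEmpty c = conjunct (lookup T c) (nonEmpty c)
  where
  conjunct : ∀ xs → 0 < length xs →
             Σ (Fin (length xs)) λ p → (headColouring xs p ≡ red) × (∀ q → headColouring xs q ≡ red → q ≡ p)
  conjunct (a ∷ as) _ = fzero , refl , head-only-red a as

headCount : ∀ {m n} → (Color → ℕ) → List (Atom m n) → ℕ
headCount w []       = 0
headCount w (a ∷ as) = w red + length as * w (tailColour (cmp a))

∑Occ-lead : ∀ {m n} (T : Template m n) (w : Color → ℕ) →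
            ∑Occ T (w ∘ lead T) ≡ listSum (map (headCount w) T)
∑Occ-lead T w = trans (sum-cong-≗ λ c → conjunct (lookup T c)) (∑-lookup (headCount w) T)
  where
  conjunct : ∀ xs → ∑[ p < length xs ] w (headColouring xs p) ≡ headCount w xs
  conjunct []       = refl
  conjunct (a ∷ as) = cong (w red +_) (∑-const (length as) _)

-- Cycles of predecessors

chain-ends : ∀ {A : Set} {R : A → A → Set} {P Q : A → Set} →
             (∀ {u v} → R u v → P u × Q v) → ∀ {x y} → TransClosure R x y → P x × Q y
chain-ends ends [ r ]    = ends r
chain-ends ends (r ∷ rs) = proj₁ (ends r) , proj₂ (chain-ends ends rs)

cycle-of-predecessors : ∀ {A : Set} (R : A → A → Set) {n} (φ : Fin n → A) (pred : Fin n → Fin n) →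
                        (∀ i → R (φ (pred i)) (φ i)) → Fin n → ∃ λ x → TransClosure R x x
cycle-of-predecessors R {n} φ pred step x₀ =
  -- among the n + 1 iterates iter 0, …, iter n two coincide
  let i , j , i<j , same = pigeonhole (n<1+n n) (iter ∘ toℕ)
  in φ (iter (toℕ i)) , subst (λ x → TransClosure R (φ x) (φ (iter (toℕ i)))) (sym same) (chain i<j)
  where
  iter : ℕ → Fin n
  iter zero    = x₀
  iter (suc t) = pred (iter t)
  chain : ∀ {s t} → s < t → TransClosure R (φ (iter t)) (φ (iter s))
  chain {s} {suc t} (s≤s s≤t) with m≤n⇒m<n∨m≡n s≤t
  ... | inj₁ s<t  = step (iter t) ∷ chain s<t
  ... | inj₂ refl = [ step (iter t) ]

indexOf : ∀ {k} → Node k k → Fin k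
indexOf (inj₁ f) = f
indexOf (inj₂ d) = d

Confined : ∀ {k} → Fin k → Atom k k → Set
Confined i a = ∀ u → OccursIn u a → indexOf u ≡ i

record Localised {k} (a : Atom k k) : Set where
  field
    level         : Fin k
    confined      : Confined level a
    witness       : Node k k
    witnessOccurs : OccursIn witness a

SupportedAt : ∀ {k} → Fin k → (Fin k → ℤ) → Set
SupportedAt i v = ∀ j → v j ≢ 0ℤ → j ≡ i

confined-by-support : ∀ {k} {i : Fin k} {a : Atom k k} →
  SupportedAt i (α a) → SupportedAt i (β a) → SupportedAt i (γ a) → Confined i a
confined-by-support sα sβ sγ (inj₁ f) (inj₁ αf≢0) = sα f αf≢0
confined-by-support sα sβ sγ (inj₁ f) (inj₂ βf≢0) = sβ f βf≢0
confined-by-support sα sβ sγ (inj₂ d) γd≢0       = sγ d γd≢0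

zero-supported : ∀ {k} {i : Fin k} → SupportedAt i zeroF
zero-supported j 0≢0 = ⊥-elim (0≢0 refl)

ind-supported : ∀ {k} (i : Fin k) z → SupportedAt i (ind i z)
ind-supported i z j ind≢0 with i ≟ᶠ j
... | yes i≡j = sym i≡j
... | no  _   = ⊥-elim (ind≢0 refl)

ind-diag : ∀ {k} (i : Fin k) z → z ≢ 0ℤ → ind i z i ≢ 0ℤ
ind-diag i z z≢0 with i ≟ᶠ i
... | yes _   = z≢0
... | no  i≢i = ⊥-elim (i≢i refl)

1≢0 : 1ℤ ≢ 0ℤ
1≢0 ()

-1≢0 : -1ℤ ≢ 0ℤ
-1≢0 ()

deltaPos-localised : ∀ {k} (i : Fin k) → Localised (deltaPos i)
deltaPos-localised i = record
  { level = i ; witness = inj₂ i ; witnessOccurs = ind-diag i 1ℤ 1≢0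
  ; confined = confined-by-support zero-supported zero-supported (ind-supported i 1ℤ) }

fPos-localised : ∀ {k} (i : Fin k) → Localised (fPos i)
fPos-localised i = record
  { level = i ; witness = inj₁ i ; witnessOccurs = inj₁ (ind-diag i 1ℤ 1≢0)
  ; confined = confined-by-support (ind-supported i 1ℤ) zero-supported zero-supported }

nonInc-localised : ∀ {k} (i : Fin k) → Localised (nonInc i)
nonInc-localised i = record
  { level = i ; witness = inj₁ i ; witnessOccurs = inj₁ (ind-diag i 1ℤ 1≢0)
  ; confined = confined-by-support (ind-supported i 1ℤ) (ind-supported i -1ℤ) zero-supported }

decr-confined : ∀ {k} (i : Fin k) → Confined i (decr i)
decr-confined i = confined-by-support (ind-supported i 1ℤ) (ind-supported i -1ℤ) (ind-supported i -1ℤ)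

decr-localised : ∀ {k} (i : Fin k) → Localised (decr i)
decr-localised i = record
  { level = i ; witness = inj₁ i ; witnessOccurs = inj₁ (ind-diag i 1ℤ 1≢0)
  ; confined = decr-confined i }

decr-links : ∀ {k} (i : Fin k) → OccursIn (inj₁ i) (decr i) × OccursIn (inj₂ i) (decr i)
decr-links i = inj₁ (ind-diag i 1ℤ 1≢0) , ind-diag i -1ℤ -1≢0

-- Templates whose components are the pairs {f_i, δ_i}

module Components {k} (T : Template k k)
  (localised : (o : Occ T) → Localised (atomAt T o))
  (linked : (i : Fin k) → Σ (Occ T) λ o → OccursIn (inj₁ i) (atomAt T o) × OccursIn (inj₂ i) (atomAt T o))
  where

  open module L (o : Occ T) = Localised (localised o)

  path⇒sameIndex : ∀ {u v} → Path T u v → indexOf u ≡ indexOf v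
  path⇒sameIndex ε                         = refl
  path⇒sameIndex ((o , u∈o , w∈o) ◅ path) =
    trans (trans (confined o _ u∈o) (sym (confined o _ w∈o))) (path⇒sameIndex path)

  edge-sym : ∀ {u v} → Edge T u v → Edge T v u
  edge-sym (o , u∈o , v∈o) = o , v∈o , u∈o

  toSymbol : ∀ u → Path T u (inj₁ (indexOf u))
  toSymbol (inj₁ f) = ε
  toSymbol (inj₂ d) = let o , f∈o , d∈o = linked d in (o , d∈o , f∈o) ◅ ε

  -- Conversely nodes of equal index are connected, so the components of G_T
  -- are exactly the pairs {f_i, δ_i}.
  sameIndex⇒path : ∀ u v → indexOf u ≡ indexOf v → Path T u v
  sameIndex⇒path u v same =
    toSymbol u ◅◅ subst (λ i → Path T (inj₁ i) v) (sym same) (reverse edge-sym (toSymbol v))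

  blueWeight : Coloring T → Fin k → Occ T → ℕ
  blueWeight η i o = δ[ level o , i ] * isBlue (η o)

  bluesAt : Coloring T → Fin k → ℕ
  bluesAt η i = ∑Occ T (blueWeight η i)

  blues-by-level : ∀ η → blues T η ≡ ∑[ i < k ] bluesAt η i
  blues-by-level η = ∑Occ-fibres T level (isBlue ∘ η)

  blueAt : ∀ η i o → 0 < blueWeight η i o → η o ≡ blue × level o ≡ i
  blueAt η i o pos = let level≡i , blue>0 = δ*-pos (level o) i _ pos in isBlue-pos blue>0 , level≡i

  bluesAt≤1 : ∀ η → BlueSeparated T η → ∀ i → bluesAt η i ≤ 1
  bluesAt≤1 η separated i =
    ∑Occ-atMostOne T (blueWeight η i) (λ o → δ*-≤1 (level o) i (isBlue≤1 (η o))) unique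
    where
    unique : ∀ o o' → 0 < blueWeight η i o → 0 < blueWeight η i o' → o ≡ o'
    unique o o' po po' with ≡-dec _≟ᶠ_ _≟ᶠ_ o o'
    ... | yes o≡o' = o≡o'
    ... | no  o≢o' =
      let b , lo = blueAt η i o po ; b' , lo' = blueAt η i o' po'
      in ⊥-elim (separated o o' o≢o' b b' (witness o) (witness o') (witnessOccurs o) (witnessOccurs o')
           (sameIndex⇒path _ _ (trans (confined o _ (witnessOccurs o))
                               (trans (trans lo (sym lo')) (sym (confined o' _ (witnessOccurs o')))))))

  red→blue : ∀ {η} (one : ExactlyOneRed T η) c q → η (c , q) ≡ blue →
             ColEdge T η (inj₁ (level (c , proj₁ (one c)))) (inj₁ (level (c , q)))
  red→blue one c q q-blue =
    witness r , witness b ,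
    sameIndex⇒path _ _ (sym (confined r _ (witnessOccurs r))) ,
    (c , proj₁ (one c) , q , proj₁ (proj₂ (one c)) , q-blue , witnessOccurs r , witnessOccurs b) ,
    sameIndex⇒path _ _ (confined b _ (witnessOccurs b))
    where
    r = (c , proj₁ (one c))
    b = (c , q)

  -- Acyclicity of G_η leaves some level without blue occurrences (the index
  -- i₀ witnesses k ≥ 1).
  blueless-level : Fin k → ∀ η → Suitable T η → ∃ λ j → bluesAt η j ≡ 0
  blueless-level i₀ η s with any? (λ j → bluesAt η j ≟ 0)
  ... | yes found = found
  ... | no  none  = ⊥-elim (Suitable.acyclic s (proj₁ cycle) (proj₂ cycle))
    where
    blueOcc : ∀ i → ∃ λ o → η o ≡ blue × level o ≡ i
    blueOcc i = let o , pos = ∑Occ-pos T (blueWeight η i) (n≢0⇒n>0 λ empty → none (i , empty))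
                in o , blueAt η i o pos
    conjunctOf : Fin k → Fin (length T)
    conjunctOf i = proj₁ (proj₁ (blueOcc i))
    pred : Fin k → Fin k
    pred i = level (conjunctOf i , proj₁ (Suitable.oneRed s (conjunctOf i)))
    step : ∀ i → ColEdge T η (inj₁ (pred i)) (inj₁ i)
    step i = let (c , q) , q-blue , level≡i = blueOcc i in
      subst (ColEdge T η (inj₁ (pred i)) ∘ inj₁) level≡i (red→blue (Suitable.oneRed s) c q q-blue)
    cycle : ∃ λ x → TransClosure (ColEdge T η) x x
    cycle = cycle-of-predecessors (ColEdge T η) inj₁ pred step i₀

  blues≤ : Fin k → ∀ η → Suitable T η → blues T η ≤ k ∸ 1
  blues≤ i₀ η s = let j , blueless = blueless-level i₀ η s in begin
    blues T η                 ≡⟨ blues-by-level η ⟩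
    ∑[ i < k ] bluesAt η i    ≤⟨ ∑-missing (bluesAt η) (bluesAt≤1 η (Suitable.blueSep s)) j blueless ⟩
    k ∸ 1                     ∎
    where open ≤-Reasoning

module LexTemplate (m : ℕ) where

  At : Set
  At = Atom (suc m) (suc m)

  T : Template (suc m) (suc m)
  T = lexTemplate (suc m)

  nonIncConjunct : Fin (suc m) → List At
  nonIncConjunct i = nonInc i ∷ map decr (filter (λ j → toℕ j <? toℕ i) (allFin (suc m)))

  finalConjunct : List At
  finalConjunct = map decr (allFin (suc m))

  deltaBlock fBlock nonIncBlock : Template (suc m) (suc m)
  deltaBlock  = map (λ i → deltaPos i ∷ []) (allFin (suc m))
  fBlock      = map (λ i → fPos i ∷ []) (allFin (suc m))
  nonIncBlock = map nonIncConjunct (filter (λ i → suc (toℕ i) <? suc m) (allFin (suc m)))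

  allConjuncts : {P : List At → Set} → (∀ i → P (deltaPos i ∷ [])) → (∀ i → P (fPos i ∷ [])) →
                 (∀ i → P (nonIncConjunct i)) → P finalConjunct → All P T
  allConjuncts onDelta onF onNonInc onFinal =
    ++⁺ (map⁺ (universal onDelta (allFin (suc m))))
        (++⁺ (map⁺ (universal onF (allFin (suc m))))
             (++⁺ (map⁺ (universal onNonInc (filter (λ i → suc (toℕ i) <? suc m) (allFin (suc m)))))
                  (onFinal ∷ [])))

  final∈T : finalConjunct ∈ T
  final∈T = ∈-++⁺ʳ deltaBlock (∈-++⁺ʳ fBlock (∈-++⁺ʳ nonIncBlock (here refl)))

  localisedAt : (o : Occ T) → Localised (atomAt T o)
  localisedAt (c , p) = entry (entry atoms c) p
    where
    decrs : ∀ {xs} → All Localised (map decr xs)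
    decrs = map⁺ (universal decr-localised _)
    atoms : All (All Localised) T
    atoms = allConjuncts (λ i → deltaPos-localised i ∷ []) (λ i → fPos-localised i ∷ [])
                         (λ i → nonInc-localised i ∷ decrs) decrs

  linked : (i : Fin (suc m)) → Σ (Occ T) λ o → OccursIn (inj₁ i) (atomAt T o) × OccursIn (inj₂ i) (atomAt T o)
  linked i =
    let o , at-o = occurrenceOf final∈T (∈-map⁺ decr (∈-allFin i))
    in o , subst (OccursIn (inj₁ i)) (sym at-o) (proj₁ (decr-links i))
         , subst (OccursIn (inj₂ i)) (sym at-o) (proj₂ (decr-links i))

  open Components T localisedAt linked public

  -- The head colouring η₀ is suitable

  η₀ : Coloring T
  η₀ = lead T

  η₀-oneRed : ExactlyOneRed T η₀
  η₀-oneRed = lead-oneRed T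
    (entry (allConjuncts {P = λ xs → 0 < length xs} (λ _ → z<s) (λ _ → z<s) (λ _ → z<s) z<s))

  BlueFree : List At → Set
  BlueFree xs = ∀ p → headColouring xs p ≢ blue

  -- Singletons and non-increase conjuncts (whose head is non-strict) have no
  -- blue atoms.
  singleton-blueFree : ∀ a → BlueFree (a ∷ [])
  singleton-blueFree a fzero ()

  nonInc-blueFree : ∀ i → BlueFree (nonIncConjunct i)
  nonInc-blueFree i fzero    ()
  nonInc-blueFree i (fsuc _) ()

  onlyFinalBlue : AtMostOneNot BlueFree T
  onlyFinalBlue =
    atMostOneNot-++ {P = BlueFree} {xs = deltaBlock} (map⁺ (universal (singleton-blueFree ∘ deltaPos) _))
      (atMostOneNot-++ {P = BlueFree} {xs = fBlock} (map⁺ (universal (singleton-blueFree ∘ fPos) _))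
        (atMostOneNot-++ {P = BlueFree} {xs = nonIncBlock} (map⁺ (universal nonInc-blueFree _))
          (atMostOneNot-singleton {P = BlueFree} finalConjunct)))

  record BlueShape (xs : List At) : Set where
    field
      separated : ∀ p q → p ≢ q → headColouring xs p ≡ blue → headColouring xs q ≡ blue →
                  ∀ u v → OccursIn u (lookup xs p) → OccursIn v (lookup xs q) → indexOf u ≢ indexOf v
      fromZero  : ∀ p q → headColouring xs p ≡ red → headColouring xs q ≡ blue →
                  ∀ u v → OccursIn u (lookup xs p) → OccursIn v (lookup xs q) →
                  (indexOf u ≡ fzero) × (indexOf v ≢ fzero)

  blueFree-shape : ∀ {xs} → BlueFree xs → BlueShape xs
  blueFree-shape noBlue = record
    { separated = λ p _ _ p-blue → ⊥-elim (noBlue p p-blue)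
    ; fromZero  = λ _ q _ q-blue → ⊥-elim (noBlue q q-blue) }

  final-level : ∀ p u → OccursIn u (lookup finalConjunct p) → toℕ (indexOf u) ≡ toℕ p
  final-level p u u∈p =
    let j , at-p , same = lookup-map-tabulate decr (λ i → i) p
    in trans (cong toℕ (decr-confined j u (subst (OccursIn u) at-p u∈p))) same

  final-shape : BlueShape finalConjunct
  final-shape = record
    { separated = λ p q p≢q _ _ u v u∈p v∈q same → p≢q (toℕ-injective
        (trans (sym (final-level p u u∈p)) (trans (cong toℕ same) (final-level q v v∈q))))
    ; fromZero  = λ
        { fzero (fsuc q) _ _ u v u∈p v∈q →
            decr-confined fzero u u∈p ,
            λ v≡0 → 0≢1+n (trans (cong toℕ (sym v≡0)) (final-level (fsuc q) v v∈q))
        ; fzero fzero _ ()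
        ; (fsuc p) _ () } }

  shapes : All BlueShape T
  shapes = allConjuncts (λ i → blueFree-shape (singleton-blueFree (deltaPos i)))
                        (λ i → blueFree-shape (singleton-blueFree (fPos i)))
                        (λ i → blueFree-shape (nonInc-blueFree i)) final-shape

  -- Two distinct blue occurrences lie in the final conjunct at distinct
  -- levels, hence in distinct components.
  η₀-blueSep : BlueSeparated T η₀
  η₀-blueSep (c , p) (c' , p') o≢o' p-blue p'-blue u v u∈p v∈p' path
    with onlyFinalBlue c c' (λ noBlue → noBlue p p-blue) (λ noBlue → noBlue p' p'-blue)
  ... | refl = BlueShape.separated (entry shapes c) p p' (o≢o' ∘ cong (c ,_)) p-blue p'-blue
                                   u v u∈p v∈p' (path⇒sameIndex path)

  -- Every edge of G_η₀ leads from level 0 to a nonzero level, so there is no cycle.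
  η₀-edge : ∀ {u v} → ColEdge T η₀ u v → (indexOf u ≡ fzero) × (indexOf v ≢ fzero)
  η₀-edge (u' , v' , u~u' , (c , p , q , p-red , q-blue , u'∈p , v'∈q) , v'~v) =
    let u'≡0 , v'≢0 = BlueShape.fromZero (entry shapes c) p q p-red q-blue u' v' u'∈p v'∈q
    in trans (path⇒sameIndex u~u') u'≡0 , v'≢0 ∘ trans (path⇒sameIndex v'~v)

  η₀-acyclic : Acyclic T η₀
  η₀-acyclic u cycle =
    let starts , ends = chain-ends {P = λ u → indexOf u ≡ fzero} {Q = λ v → indexOf v ≢ fzero} η₀-edge cycle
    in ends starts

  η₀-suitable : Suitable T η₀
  η₀-suitable = record { oneRed = η₀-oneRed ; blueSep = η₀-blueSep ; acyclic = η₀-acyclic }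

  uncoloured : List At → ℕ
  uncoloured = headCount isWhite

  nonIncIndices : List (Fin (suc m))
  nonIncIndices = filter (λ i → suc (toℕ i) <? suc m) (allFin (suc m))

  listSum-T : (g : List At → ℕ) → listSum (map g T) ≡
    listSum (map g deltaBlock) + (listSum (map g fBlock) + (listSum (map g nonIncBlock) + (g finalConjunct + 0)))
  listSum-T g = trans (listSum-map-++ g deltaBlock (fBlock ++ nonIncBlock ++ finalConjunct ∷ []))
    (cong (listSum (map g deltaBlock) +_) (trans (listSum-map-++ g fBlock (nonIncBlock ++ finalConjunct ∷ []))
      (cong (listSum (map g fBlock) +_) (listSum-map-++ g nonIncBlock (finalConjunct ∷ [])))))

  singletons-uncoloured : (f : Fin (suc m) → At) →
                          listSum (map uncoloured (map (λ i → f i ∷ []) (allFin (suc m)))) ≡ 0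
  singletons-uncoloured f =
    trans (cong listSum (sym (map-∘ {g = uncoloured} {f = λ i → f i ∷ []} (allFin (suc m)))))
          (listSum-map-zero {g = λ i → uncoloured (f i ∷ [])} (λ _ → refl) (allFin (suc m)))

  final-uncoloured : uncoloured finalConjunct ≡ 0
  final-uncoloured = *-zeroʳ (length (map decr (tabulate {n = m} fsuc)))

  final-blues : headCount isBlue finalConjunct ≡ m
  final-blues = trans (*-identityʳ _) (trans (length-map decr (tabulate {n = m} fsuc)) (length-tabulate fsuc))

  nonInc-uncoloured : ∀ i → uncoloured (nonIncConjunct i) ≡ toℕ i
  nonInc-uncoloured i = begin
    length (map decr below) * 1     ≡⟨ *-identityʳ _ ⟩
    length (map decr below)         ≡⟨ length-map decr below ⟩
    length below                    ≡⟨ length≡listSum below ⟩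
    listSum (map (λ _ → 1) below)   ≡⟨ listSum-filter (λ j → toℕ j <? toℕ i) (λ _ → 1) (λ j → j) ⟩
    ∑[ j < suc m ] (if does (toℕ j <? toℕ i) then 1 else 0)
                                    ≡⟨ ∑-below (λ _ → 1) (<⇒≤ (toℕ<n i)) ⟩
    ∑[ j < toℕ i ] 1                ≡⟨ trans (∑-const (toℕ i) 1) (*-identityʳ _) ⟩
    toℕ i                           ∎
    where
    open ≡-Reasoning
    below : List (Fin (suc m))
    below = filter (λ j → toℕ j <? toℕ i) (allFin (suc m))

  uncoloured-T : listSum (map uncoloured T) ≡ listSum (map uncoloured nonIncBlock)
  uncoloured-T = begin
    listSum (map uncoloured T)
      ≡⟨ listSum-T uncoloured ⟩
    listSum (map uncoloured deltaBlock) + (listSum (map uncoloured fBlock) +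
      (listSum (map uncoloured nonIncBlock) + (uncoloured finalConjunct + 0)))
      ≡⟨ cong₂ _+_ (singletons-uncoloured deltaPos) (cong₂ _+_ (singletons-uncoloured fPos)
           (cong (listSum (map uncoloured nonIncBlock) +_) (trans (+-identityʳ _) final-uncoloured))) ⟩
    listSum (map uncoloured nonIncBlock) + 0
      ≡⟨ +-identityʳ _ ⟩
    listSum (map uncoloured nonIncBlock) ∎
    where open ≡-Reasoning

  uncoloured-nonIncBlock : listSum (map uncoloured nonIncBlock) ≡ ∑[ i < m ] toℕ i
  uncoloured-nonIncBlock = begin
    listSum (map uncoloured nonIncBlock)
      ≡⟨ cong listSum (sym (map-∘ nonIncIndices)) ⟩
    listSum (map (uncoloured ∘ nonIncConjunct) nonIncIndices)
      ≡⟨ cong listSum (map-cong nonInc-uncoloured nonIncIndices) ⟩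
    listSum (map toℕ nonIncIndices)
      ≡⟨ listSum-filter (λ i → suc (toℕ i) <? suc m) toℕ (λ i → i) ⟩
    ∑[ i < suc m ] (if does (toℕ i <? m) then toℕ i else 0)
      ≡⟨ ∑-below (λ i → i) (n≤1+n m) ⟩
    ∑[ i < m ] toℕ i ∎
    where open ≡-Reasoning

  η₀-degree : deg T η₀ ≡ m * (m ∸ 1) / 2
  η₀-degree = begin
    deg T η₀                              ≡⟨ deg≡∑Occ T η₀ ⟩
    ∑Occ T (isWhite ∘ η₀)                 ≡⟨ ∑Occ-lead T isWhite ⟩
    listSum (map uncoloured T)            ≡⟨ uncoloured-T ⟩
    listSum (map uncoloured nonIncBlock)  ≡⟨ uncoloured-nonIncBlock ⟩
    ∑[ i < m ] toℕ i                      ≡⟨ triangle m ⟩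
    m * (m ∸ 1) / 2                       ∎
    where open ≡-Reasoning

  η₀-blues : m ≤ blues T η₀
  η₀-blues = begin
    m                                     ≡⟨ final-blues ⟨
    headCount isBlue finalConjunct        ≤⟨ ∈⇒≤listSum (∈-map⁺ (headCount isBlue) final∈T) ⟩
    listSum (map (headCount isBlue) T)    ≡⟨ ∑Occ-lead T isBlue ⟨
    blues T η₀                            ∎
    where open ≤-Reasoning

lemma6p27 : (k : ℕ) → k ≥ 1 → HasDegree (lexTemplate k) (((k ∸ 1) * (k ∸ 2)) / 2)
lemma6p27 (suc m) _ = (η₀ , η₀-suitable , η₀-degree) , minimal
  where
  open LexTemplate m
  -- A suitable colouring has at most m ≤ blues η₀ blue atoms, hence degree at least that of η₀.
  minimal : (η : Coloring T) → Suitable T η → m * (m ∸ 1) / 2 ≤ deg T η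
  minimal η s = subst (_≤ deg T η) η₀-degree
    (deg-minimal T η₀-oneRed (Suitable.oneRed s) (≤-trans (blues≤ fzero η s) η₀-blues))
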